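{- Let $D=\langle d_1,\ldots,d_n\rangle$ be an instance of $2$-Visits with discretized sequence $A=\langle a_1,\ldots,a_n\rangle$. Then for every $i\in\{1,\ldots,n\}$, in any feasible schedule at most $n-i$ primary visits occur at positions strictly greater than $a_i$.
   Context: $2$-Visits: given a non-decreasing sequence of positive integers $d_1,\ldots,d_n$, a feasible schedule is a sequence of length $2n$ (positions $1,\ldots,2n$) containing, for each node $i$, one primary and one secondary visit, such that the primary visit of $i$ is at a position $t_i\le d_i$ and the secondary visit of $i$ is either before its primary visit or at a position at most $t_i+d_i$. The discretized sequence is defined by $a_n=d_n$ and $a_i=\min\{a_{i+1}-1,d_i\}$ for $i<n$. -}

module Defs where

open import Data.Nat as ℕ using (ℕ; zero; suc; _+_; _*_; _≤_; _<_)
open import Data.Integer as ℤ using (ℤ; +_; _⊓_; _-_)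
open import Data.Fin as Fin using (Fin; toℕ)
open import Data.Fin.Properties using (_≟_)
open import Data.Product using (_×_; _,_)
open import Data.Sum using (_⊎_)
open import Data.List using (List; length; filter)
open import Data.List.Base using (allFin)
open import Function.Bundles using (_↔_; Inverse)

-- Nodes are Fin n (node k here is node k+1 of the paper).
-- Kinds of visits.
data Kind : Set where
  primary secondary : Kind

Visit : ℕ → Set
Visit n = Fin n × Kind

-- A schedule: a sequence of length 2n (slot k ∈ Fin (2n) is position k+1)
-- containing every visit exactly once, i.e. a bijection between slots and visits.
Schedule : ℕ → Set
Schedule n = Fin (2 * n) ↔ Visit n

pos : ∀ {n} → Schedule n → Visit n → ℕ
pos σ v = suc (toℕ (Inverse.from σ v))

primPos : ∀ {n} → Schedule n → Fin n → ℕ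
primPos σ i = pos σ (i , primary)

secPos : ∀ {n} → Schedule n → Fin n → ℕ
secPos σ i = pos σ (i , secondary)

Feasible : ∀ {n} → (Fin n → ℕ) → Schedule n → Set
Feasible {n} d σ = (i : Fin n) →
  (primPos σ i ≤ d i) ×
  (secPos σ i < primPos σ i ⊎ secPos σ i ≤ primPos σ i + d i)

-- Discretized sequence (over ℤ, since a_i may become non-positive):
-- a_n = d_n, a_i = min (a_{i+1} - 1) d_i.
discretize : ∀ n → (Fin n → ℕ) → Fin n → ℤ
discretize (suc zero) d Fin.zero = + d Fin.zero
discretize (suc (suc n)) d Fin.zero =
  (discretize (suc n) (λ j → d (Fin.suc j)) Fin.zero - + 1) ⊓ + d Fin.zero
discretize (suc n) d (Fin.suc i) = discretize n (λ j → d (Fin.suc j)) i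

Positive : ∀ {n} → (Fin n → ℕ) → Set
Positive {n} d = (i : Fin n) → 1 ≤ d i

NonDecreasing : ∀ {n} → (Fin n → ℕ) → Set
NonDecreasing {n} d = (i j : Fin n) → i Fin.≤ j → d i ≤ d j

countPrimaryAfter : ∀ {n} → Schedule n → ℤ → ℕ
countPrimaryAfter {n} σ x = length (filter (λ j → x ℤ.<? + primPos σ j) (allFin n))

-- Unfolding the recursion, a_i = min over k ≥ i of d_k − (k − i), so some k ≥ i has
-- d_k ≤ a_i + (k − i). A node j ≤ k whose primary visit lies after a_i has it in the
-- window (a_i, d_j] ⊆ (a_i, a_i + (k − i)], which holds at most k − i positions, and
-- there are only n − 1 − k nodes beyond k. Both counts together give n − 1 − i; the proof
-- packages them as a single injection of the late nodes into {0, …, n − 2 − i}.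
module Submission where

open import Defs
open import Data.Nat as ℕ using (ℕ; zero; suc; _+_; _∸_; _≤_; _<_; z≤n; s≤s)
import Data.Nat.Properties as ℕ
open import Data.Integer as ℤ using (ℤ; +_; -[1+_]; _-_)
import Data.Integer.Properties as ℤ
open import Data.Fin as Fin using (Fin; toℕ; fromℕ<; punchOut)
import Data.Fin.Properties as Fin
open import Data.Product using (∃; _×_; _,_; proj₁)
open import Data.Sum using (inj₁; inj₂)
open import Data.Vec.Functional using (tail)
open import Data.List using (length; filter; tabulate; allFin)
open import Relation.Nullary using (yes; no; contradiction)
open import Relation.Unary using (Pred; Decidable)
open import Relation.Binary.PropositionalEquality
open import Function.Base using (_∘_)
open import Function.Bundles using (Inverse; Injection)
open import Function.Properties.Inverse using (↔-sym; Inverse⇒Injection)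

length-filter-tabulate≤ : ∀ {a ℓ n m} {A : Set a} {P : Pred A ℓ} (P? : Decidable P) (g : Fin n → A)
  (f : ∀ j → P (g j) → Fin m) → (∀ {x y} p q → f x p ≡ f y q → x ≡ y) →
  length (filter P? (tabulate g)) ≤ m
length-filter-tabulate≤ {n = zero} P? g f f-inj = z≤n
length-filter-tabulate≤ {n = suc n} {m} {P = P} P? g f f-inj with P? (g Fin.zero) | m
... | no _ | _ = length-filter-tabulate≤ P? (λ j → g (Fin.suc j))
  (λ j → f (Fin.suc j)) (λ p q e → Fin.suc-injective (f-inj p q e))
... | yes p₀ | zero with () ← f Fin.zero p₀
... | yes p₀ | suc m = s≤s (length-filter-tabulate≤ P? (λ j → g (Fin.suc j)) f′ f′-inj)
  where
  f₀≢f : ∀ {j} q → f Fin.zero p₀ ≢ f (Fin.suc j) q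
  f₀≢f q e with () ← f-inj p₀ q e
  f′ : ∀ j → P (g (Fin.suc j)) → Fin m
  f′ j q = punchOut (f₀≢f q)
  f′-inj : ∀ {x y} p q → f′ x p ≡ f′ y q → x ≡ y
  f′-inj p q e = Fin.suc-injective (f-inj p q (Fin.punchOut-injective (f₀≢f p) (f₀≢f q) e))

length-filter-allFin≤ : ∀ {ℓ n m} {P : Pred (Fin n) ℓ} (P? : Decidable P) (h : Fin n → ℕ) →
  (∀ j → P j → h j < m) → (∀ {x y} → P x → P y → h x ≡ h y → x ≡ y) →
  length (filter P? (allFin n)) ≤ m
length-filter-allFin≤ P? h h<m h-inj =
  length-filter-tabulate≤ P? (λ j → j) (λ j p → fromℕ< (h<m j p))
    (λ p q e → h-inj p q (Fin.fromℕ<-injective _ _ (h<m _ p) (h<m _ q) e))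

discretize-witness : ∀ n (d : Fin n → ℕ) (i : Fin n) →
  ∃ λ k → i Fin.≤ k × + d k ℤ.≤ discretize n d i ℤ.+ + (toℕ k ∸ toℕ i)
discretize-witness (suc zero) d Fin.zero = Fin.zero , z≤n , ℤ.≤-reflexive (sym (ℤ.+-identityʳ _))
discretize-witness (suc (suc n)) d Fin.zero
  with k , _ , dₖ≤ ← discretize-witness (suc n) (tail d) Fin.zero
  with ℤ.≤-total (discretize (suc n) (tail d) Fin.zero - + 1) (+ d Fin.zero)
... | inj₁ le rewrite ℤ.i≤j⇒i⊓j≡i le =
  Fin.suc k , z≤n , subst (+ d (Fin.suc k) ℤ.≤_) (sym (ℤ.+-assoc a₀ (ℤ.- + 1) (+ suc (toℕ k)))) dₖ≤
  where
  a₀ : ℤ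
  a₀ = discretize (suc n) (tail d) Fin.zero
... | inj₂ ge rewrite ℤ.i≥j⇒i⊓j≡j ge = Fin.zero , z≤n , ℤ.≤-reflexive (sym (ℤ.+-identityʳ _))
discretize-witness (suc (suc n)) d (Fin.suc i)
  with k , i≤k , dₖ≤ ← discretize-witness (suc n) (tail d) i =
  Fin.suc k , s≤s i≤k , dₖ≤

natural-upper-bound : (a : ℤ) → ∃ λ b → a ℤ.≤ + b × (∀ t → a ℤ.< + suc t → b ≤ t)
natural-upper-bound (+ b) = b , ℤ.≤-refl , λ { t (ℤ.+<+ (s≤s b≤t)) → b≤t }
natural-upper-bound -[1+ c ] = 0 , ℤ.-≤+ , λ _ _ → z≤n

-- 0-based, so that primPos σ j ≡ suc (primarySlot σ j).
primarySlot : ∀ {n} → Schedule n → Fin n → ℕ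
primarySlot σ j = toℕ (Inverse.from σ (j , primary))

primarySlot-injective : ∀ {n} (σ : Schedule n) {x y} → primarySlot σ x ≡ primarySlot σ y → x ≡ y
primarySlot-injective σ e =
  cong proj₁ (Injection.injective (Inverse⇒Injection (↔-sym σ)) (Fin.toℕ-injective e))

late-primaries≤ : ∀ {n} {d : Fin n → ℕ} → NonDecreasing d → (σ : Schedule n) → Feasible d σ →
  (i k : Fin n) → i Fin.≤ k → (b : ℕ) → d k ≤ b + (toℕ k ∸ toℕ i) →
  ∀ {ℓ} {P : Pred (Fin n) ℓ} (P? : Decidable P) → (∀ j → P j → b ≤ primarySlot σ j) →
  length (filter P? (allFin n)) ≤ n ∸ suc (toℕ i)
late-primaries≤ {n} {d} d-mono σ feasible i k i≤k b dₖ≤ {P = P} P? b≤slot =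
  length-filter-allFin≤ P? h h<n∸suc-i h-inj
  where
  slot : Fin n → ℕ
  slot = primarySlot σ

  -- Nodes j ≤ k are sent to slot j ∸ b < k − i, nodes j > k to toℕ j ∸ suc i ≥ k − i.
  h : Fin n → ℕ
  h j with j Fin.≤? k
  ... | yes _ = slot j ∸ b
  ... | no _ = toℕ j ∸ suc (toℕ i)

  early< : ∀ {j} → P j → j Fin.≤ k → slot j ∸ b < toℕ k ∸ toℕ i
  early< {j} p j≤k =
    ℕ.≤-trans (ℕ.∸-monoˡ-< slot<b+k∸i (b≤slot j p)) (ℕ.≤-reflexive (ℕ.m+n∸m≡n b _))
    where
    slot<b+k∸i : slot j < b + (toℕ k ∸ toℕ i)
    slot<b+k∸i = ℕ.≤-trans (proj₁ (feasible j)) (ℕ.≤-trans (d-mono j k j≤k) dₖ≤)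

  late≥ : ∀ {j} → k Fin.< j → toℕ k ∸ toℕ i ≤ toℕ j ∸ suc (toℕ i)
  late≥ k<j = ℕ.∸-monoˡ-≤ (suc (toℕ i)) k<j

  late-index : ∀ {j} → k Fin.< j → suc (toℕ i) ≤ toℕ j
  late-index k<j = ℕ.≤-trans (s≤s i≤k) k<j

  h<n∸suc-i : ∀ j → P j → h j < n ∸ suc (toℕ i)
  h<n∸suc-i j p with j Fin.≤? k
  ... | yes j≤k = ℕ.≤-trans (early< p j≤k) (ℕ.∸-monoˡ-≤ (suc (toℕ i)) (Fin.toℕ<n k))
  ... | no j≰k = ℕ.∸-monoˡ-< (Fin.toℕ<n j) (late-index (ℕ.≰⇒> j≰k))

  h-inj : ∀ {x y} → P x → P y → h x ≡ h y → x ≡ y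
  h-inj {x} {y} p q with x Fin.≤? k | y Fin.≤? k
  ... | yes _ | yes _ = primarySlot-injective σ ∘ ℕ.∸-cancelʳ-≡ (b≤slot x p) (b≤slot y q)
  ... | no x≰k | no y≰k =
    Fin.toℕ-injective ∘ ℕ.∸-cancelʳ-≡ (late-index (ℕ.≰⇒> x≰k)) (late-index (ℕ.≰⇒> y≰k))
  ... | yes x≤k | no y≰k =
    λ e → contradiction e (ℕ.<⇒≢ (ℕ.<-≤-trans (early< p x≤k) (late≥ (ℕ.≰⇒> y≰k))))
  ... | no x≰k | yes y≤k =
    λ e → contradiction (sym e) (ℕ.<⇒≢ (ℕ.<-≤-trans (early< q y≤k) (late≥ (ℕ.≰⇒> x≰k))))

lemma3 : (n : ℕ) (d : Fin n → ℕ) → Positive d → NonDecreasing d →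
    (σ : Schedule n) → Feasible d σ →
    (i : Fin n) → countPrimaryAfter σ (discretize n d i) ≤ n ∸ suc (toℕ i)
lemma3 n d _ d-mono σ feasible i
  with k , i≤k , dₖ≤aᵢ+k∸i ← discretize-witness n d i
  with b , aᵢ≤b , b≤slot ← natural-upper-bound (discretize n d i) =
  late-primaries≤ d-mono σ feasible i k i≤k b dₖ≤b+k∸i
    (λ j → discretize n d i ℤ.<? + primPos σ j) (λ j → b≤slot (primarySlot σ j))
  where
  dₖ≤b+k∸i : d k ≤ b + (toℕ k ∸ toℕ i)
  dₖ≤b+k∸i = ℤ.drop‿+≤+ (ℤ.≤-trans dₖ≤aᵢ+k∸i (ℤ.+-monoˡ-≤ (+ (toℕ k ∸ toℕ i)) aᵢ≤b))
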